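{- Let $A=\langle S,\Sigma,E,s_0\rangle$ and $A'=\langle S',\Sigma_{\mathcal{F}},E',s_0'\rangle$ be transition systems ($\Sigma$ possibly containing the silent action $\tau$), and let $\mathcal{M}\subseteq S\times S'$ be a relation (where $A$ is considered as $A^M$). Then $\mathcal{M}$ is a weak masking simulation if and only if: (A) $s_0\,\mathcal{M}\,s_0'$; and (B) for all $s\in S$, $s'\in S'$ with $s\,\mathcal{M}\,s'$ and all $e\in\Sigma\cup\{\tau\}$: (1) if $s\xRightarrow{e}t$ in $A$ then there is $t'\in S'$ with $s'\xRightarrow{e}t'$ in $A'$ and $t\,\mathcal{M}\,t'$; (2) if $s'\xRightarrow{e}t'$ in $A'$ then there is $t\in S$ with $s\xRightarrow{e}t$ in $A$ and $t\,\mathcal{M}\,t'$; (3) if $s'\xRightarrow{F}t'$ in $A'$ for some $F\in\mathcal{F}$, then there is $t\in S$ with $s\xRightarrow{M}t$ in $A^M$ and $t\,\mathcal{M}\,t'$.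
   Context: A transition system is a tuple $\langle S,\Sigma,E,s_0\rangle$ with $S$ a finite set of states, $\Sigma$ a finite alphabet, $E\subseteq S\times\Sigma\times S$ a set of labelled transitions (written $s\xrightarrow{e}t$), and $s_0\in S$ the initial state; every state is assumed to have at least one outgoing transition. $\mathcal{F}=\{F_0,\dots,F_n\}$ is a finite set of fault labels disjoint from $\Sigma$ (and not containing $\tau$), and $\Sigma_{\mathcal{F}}=\Sigma\cup\mathcal{F}$. $M$ is a fresh label not in $\Sigma\cup\mathcal{F}$ (masking label). For $A=\langle S,\Sigma,E,s_0\rangle$, $A^M=\langle S,\Sigma\cup\{M\},E\cup\{s\xrightarrow{M}s\mid s\in S\},s_0\rangle$. Weak transitions: for $e\in\Sigma$ (with $e\neq\tau$), $\xRightarrow{e}=(\xrightarrow{\tau})^*\circ\xrightarrow{e}\circ(\xrightarrow{\tau})^*$; $\xRightarrow{\tau}=(\xrightarrow{\tau})^*$ (reflexive–transitive closure, so $s\xRightarrow{\tau}s$ always); for $e\in\{M\}\cup\mathcal{F}$, $\xRightarrow{e}=\xrightarrow{e}$. A weak masking simulation is a relation $\mathcal{M}\subseteq S\times S'$ such that: (A) $s_0\,\mathcal{M}\,s_0'$; and (B) for all $s\,\mathcal{M}\,s'$ and all $e\in\Sigma\cup\{\tau\}$: (1) if $s\xrightarrow{e}t$ in $A$ then there is $t'$ with $s'\xRightarrow{e}t'$ in $A'$ and $t\,\mathcal{M}\,t'$; (2) if $s'\xrightarrow{e}t'$ in $A'$ then there is $t$ with $s\xRightarrow{e}t$ in $A$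 and $t\,\mathcal{M}\,t'$; (3) if $s'\xrightarrow{F}t'$ in $A'$ for some $F\in\mathcal{F}$ then there is $t$ with $s\xrightarrow{M}t$ in $A^M$ and $t\,\mathcal{M}\,t'$. -}

module Defs where

open import Data.Nat using (ℕ; suc)
open import Data.Fin using (Fin)
open import Data.Product using (Σ; ∃; ∃₂; _×_; _,_)
open import Relation.Binary.PropositionalEquality using (_≡_)
open import Relation.Binary.Construct.Closure.ReflexiveTransitive using (Star)

data Act (k : ℕ) : Set where
  τ   : Act k
  act : Fin k → Act k

data LabM (k : ℕ) : Set where
  lab  : Act k → LabM k
  mask : LabM k

-- Labels of A':  Σ_F ∪ {τ} = Σ ∪ {τ} ∪ F, with F = {F_0,…,F_n} = Fin (suc n)
data LabF (k n : ℕ) : Set where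
  lab   : Act k → LabF k n
  fault : Fin (suc n) → LabF k n

record TS (L : Set) : Set₁ where
  field
    nS    : ℕ
    E     : Fin nS → L → Fin nS → Set
    s₀    : Fin nS
    total : ∀ s → ∃₂ λ e t → E s e t

open TS public

State : ∀ {L} → TS L → Set
State A = Fin (nS A)

LTS : ℕ → Set₁
LTS k = TS (Act k)

LTSF : ℕ → ℕ → Set₁
LTSF k n = TS (LabF k n)

data EM {k : ℕ} (A : LTS k) : State A → LabM k → State A → Set where
  old  : ∀ {s e t} → E A s e t → EM A s (lab e) t
  loop : ∀ {s} → EM A s mask s

_^M : ∀ {k} → LTS k → TS (LabM k)
A ^M = record
  { nS = nS A ; E = EM A ; s₀ = s₀ A
  ; total = λ s → mask , s , loop }

module Weak {k : ℕ} {L : Set} (B : TS L) (ι : Act k → L) where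
  τ-step : State B → State B → Set
  τ-step s t = E B s (ι τ) t

  _⇒[_]_ : State B → Act k → State B → Set
  s ⇒[ τ ] t = Star τ-step s t
  s ⇒[ act a ] t =
    ∃₂ λ u v → Star τ-step s u × E B u (ι (act a)) v × Star τ-step v t

-- Weak transitions in A^M (for e ∈ Σ ∪ {τ}), and ⇒M = →M
_⊢_⇒[_]_ : ∀ {k} (A : LTS k) → State A → Act k → State A → Set
A ⊢ s ⇒[ e ] t = Weak._⇒[_]_ (A ^M) lab s e t

_⊢_⇒M_ : ∀ {k} (A : LTS k) → State A → State A → Set
A ⊢ s ⇒M t = E (A ^M) s mask t

-- Weak transitions in A' (for e ∈ Σ ∪ {τ}), and ⇒F = →F
_⊢'_⇒[_]_ : ∀ {k n} (A' : LTSF k n) → State A' → Act k → State A' → Set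
A' ⊢' s ⇒[ e ] t = Weak._⇒[_]_ A' lab s e t

_⊢'_⇒F[_]_ : ∀ {k n} (A' : LTSF k n) → State A' → Fin (suc n) → State A' → Set
A' ⊢' s ⇒F[ F ] t = E A' s (fault F) t

record IsWeakMaskingSim {k n} (A : LTS k) (A' : LTSF k n)
       (R : State A → State A' → Set) : Set where
  field
    init  : R (s₀ A) (s₀ A')
    cond1 : ∀ {s s'} → R s s' → ∀ e {t} → E (A ^M) s (lab e) t →
            ∃ λ t' → A' ⊢' s' ⇒[ e ] t' × R t t'
    cond2 : ∀ {s s'} → R s s' → ∀ e {t'} → E A' s' (lab e) t' →
            ∃ λ t → A ⊢ s ⇒[ e ] t × R t t'
    cond3 : ∀ {s s'} → R s s' → ∀ F {t'} → E A' s' (fault F) t' →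
            ∃ λ t → A ⊢ s ⇒M t × R t t'

record WeakCharacterisation {k n} (A : LTS k) (A' : LTSF k n)
       (R : State A → State A' → Set) : Set where
  field
    init  : R (s₀ A) (s₀ A')
    cond1 : ∀ {s s'} → R s s' → ∀ e {t} → A ⊢ s ⇒[ e ] t →
            ∃ λ t' → A' ⊢' s' ⇒[ e ] t' × R t t'
    cond2 : ∀ {s s'} → R s s' → ∀ e {t'} → A' ⊢' s' ⇒[ e ] t' →
            ∃ λ t → A ⊢ s ⇒[ e ] t × R t t'
    cond3 : ∀ {s s'} → R s s' → ∀ F {t'} → A' ⊢' s' ⇒F[ F ] t' →
            ∃ λ t → A ⊢ s ⇒M t × R t t'

module Submission where

-- Proof idea.  Conditions (A) and (3) are literally the same in both
-- formulations, so only (1) and (2) need an argument.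
--
--  * Weak ⇒ strong: every single transition s -e→ t is itself a weak
--    transition s =e⇒ t (surrounded by empty τ-sequences).
--  * Strong ⇒ weak: one general fact about two systems B, B' sharing the
--    actions Σ ∪ {τ}: if every single step of B from a related pair is
--    matched by a weak step of B', then so is every weak step of B.
--    It is proved by induction on the τ-prefix and τ-suffix of the weak
--    step, using that weak steps absorb τ-sequences on either side.
--    Clause (1) is this fact for B = A^M, B' = A'; clause (2) is the same
--    fact for B = A', B' = A^M and the converse relation.

open import Defs
open import Data.Nat using (ℕ)
open import Function.Base using (flip)
open import Function.Bundles using (_⇔_; mk⇔)
open import Data.Product using (∃; _×_; _,_)
open import Relation.Binary.Construct.Closure.ReflexiveTransitive using (Star; ε; _◅_; _◅◅_)

module WeakSteps {k : ℕ} {L : Set} (B : TS L) (ι : Act k → L) where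
  open Weak B ι

  step⇒weak : ∀ e {s t} → E B s (ι e) t → s ⇒[ e ] t
  step⇒weak τ       st = st ◅ ε
  step⇒weak (act a) st = _ , _ , ε , st , ε

  τ-sandwich : ∀ e {s u v t} → Star τ-step s u → u ⇒[ e ] v → Star τ-step v t →
               s ⇒[ e ] t
  τ-sandwich τ       p w q                       = p ◅◅ w ◅◅ q
  τ-sandwich (act a) p (x , y , px , st , qy) q = x , y , p ◅◅ px , st , qy ◅◅ q

module WeakLifting {k : ℕ} {L L' : Set} (B : TS L) (ι : Act k → L)
                   (B' : TS L') (ι' : Act k → L')
                   (R : State B → State B' → Set) where
  open Weak B ι using (τ-step; _⇒[_]_)
  open Weak B' ι' using () renaming (τ-step to τ-step'; _⇒[_]_ to _⇒'[_]_)
  open WeakSteps B' ι' using (τ-sandwich)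

  StepMatched : Set
  StepMatched = ∀ {s s'} → R s s' → ∀ e {t} → E B s (ι e) t →
                ∃ λ t' → s' ⇒'[ e ] t' × R t t'

  module _ (matched : StepMatched) where

    τ-lift : ∀ {s s' t} → R s s' → Star τ-step s t →
             ∃ λ t' → Star τ-step' s' t' × R t t'
    τ-lift r ε = _ , ε , r
    τ-lift r (st ◅ sts) with matched r τ st
    ... | _ , p , r₁ with τ-lift r₁ sts
    ... | t' , q , r₂ = t' , p ◅◅ q , r₂

    weak-lift : ∀ {s s'} → R s s' → ∀ e {t} → s ⇒[ e ] t →
                ∃ λ t' → s' ⇒'[ e ] t' × R t t'
    weak-lift r τ p = τ-lift r p
    weak-lift r (act a) (_ , _ , p , st , q) with τ-lift r p
    ... | _ , p' , ru with matched ru (act a) st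
    ... | _ , w , rv with τ-lift rv q
    ... | t' , q' , rt = t' , τ-sandwich (act a) p' w q' , rt

module _ {k n} (A : LTS k) (A' : LTSF k n) (R : State A → State A' → Set) where

  open WeakLifting (A ^M) lab A' lab R
    using () renaming (weak-lift to forward-lift)
  open WeakLifting A' lab (A ^M) lab (flip R)
    using () renaming (weak-lift to backward-lift)

  strong⇒weak : IsWeakMaskingSim A A' R → WeakCharacterisation A A' R
  strong⇒weak W = record
    { init  = init
    ; cond1 = forward-lift cond1
    ; cond2 = backward-lift cond2
    ; cond3 = cond3
    }
    where open IsWeakMaskingSim W

  weak⇒strong : WeakCharacterisation A A' R → IsWeakMaskingSim A A' R
  weak⇒strong W = record
    { init  = init
    ; cond1 = λ r e st → cond1 r e (WeakSteps.step⇒weak (A ^M) lab e st)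
    ; cond2 = λ r e st → cond2 r e (WeakSteps.step⇒weak A' lab e st)
    ; cond3 = cond3
    }
    where open WeakCharacterisation W

theorem2 : ∀ {k n} (A : LTS k) (A' : LTSF k n) (R : State A → State A' → Set) →
    IsWeakMaskingSim A A' R ⇔ WeakCharacterisation A A' R
theorem2 A A' R = mk⇔ (strong⇒weak A A' R) (weak⇒strong A A' R)
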